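{- Let $\Phi$ be a second-order sentence over a finite relational signature $\tau$. The following are equivalent: (1) $\Phi$ is preserved under bijective homomorphisms, i.e., whenever $\mathbb{A}\models\Phi$ for a finite $\tau$-structure $\mathbb{A}$ and there is a bijective homomorphism from $\mathbb{A}$ to a finite $\tau$-structure $\mathbb{B}$, then $\mathbb{B}\models\Phi$. (2) $\Phi$ is logically equivalent (over finite structures) to a positive SO sentence.
   Context: SO (second-order logic) extends first-order logic (with equality) by quantification over relation variables. A formula is normalized if it is in prenex form: a second-order quantifier prefix, then a first-order quantifier prefix, then a quantifier-free formula; it is CNF-normalized if moreover the quantifier-free part is in conjunctive normal form. A CNF-normalized SO $\tau$-formula is positive if every atomic formula $R(\bar x)$ with $R\in\tau$ occurs only unnegated in its clauses (atoms involving second-order variables or equality may occur with either sign). A normalized SO formula is positive if some CNF obtained from its quantifier-free part by De Morgan's laws and distributivity witnesses this. The set of positive SO sentences is the closure of positive normalized SO sentences under internal conjunctions and disjunctions: if $\mathrm{Q}_1S_1\cdots\mathrm{Q}_nS_n.\phi_1$ and $\mathrm{Q}_1S_1\cdots\mathrm{Q}_nS_n.\phi_2$ are in the set, so are $\mathrm{Q}_1S_1\cdots\mathrm{Q}_nS_n(\phi_1\wedge\phi_2)$ and $\mathrm{Q}_1S_1\cdots\mathrm{Q}_nS_n(\phi_1\vee\phi_2)$. Only finite structures are considered as models. -}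

module Defs where

open import Data.Nat using (ℕ; zero; suc)
open import Data.Fin using (Fin; zero; suc)
open import Data.Bool using (Bool; T)
open import Data.Vec using (Vec; []; _∷_; map)
open import Data.List using (List; []; _∷_)
open import Data.Product using (Σ; _×_; _,_)
open import Data.Sum using (_⊎_)
open import Relation.Nullary using (¬_)
open import Relation.Binary.PropositionalEquality using (_≡_)
open import Relation.Binary.Construct.Closure.Equivalence using (EqClosure)
open import Function.Definitions using (Bijective)
open import Function.Bundles using (_⇔_)

record Signature : Set where
  field
    nsym  : ℕ
    arity : Fin nsym → ℕ
open Signature public

Sym : Signature → Set
Sym τ = Fin (nsym τ)

record Structure (τ : Signature) : Set where
  field
    size : ℕ
    interp : (R : Sym τ) → Vec (Fin (suc size)) (arity τ R) → Bool
open Structure public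

Dom : ∀ {τ} → Structure τ → Set
Dom A = Fin (suc (size A))

IsHom : ∀ {τ} (A B : Structure τ) → (Dom A → Dom B) → Set
IsHom {τ} A B h = (R : Sym τ) (t : Vec (Dom A) (arity τ R)) →
  T (interp A R t) → T (interp B R (map h t))

-- Formula τ Γ m : Γ = arities of the free second-order variables
-- (de Bruijn, innermost binder first), m = number of free first-order
-- variables (de Bruijn, Fin m).

data SVar : List ℕ → ℕ → Set where
  here  : ∀ {a Γ} → SVar (a ∷ Γ) a
  there : ∀ {a b Γ} → SVar Γ a → SVar (b ∷ Γ) a

data Formula (τ : Signature) : List ℕ → ℕ → Set where
  rel   : ∀ {Γ m} (R : Sym τ) → Vec (Fin m) (arity τ R) → Formula τ Γ m
  svar  : ∀ {Γ m a} → SVar Γ a → Vec (Fin m) a → Formula τ Γ m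
  equ   : ∀ {Γ m} → Fin m → Fin m → Formula τ Γ m
  neg   : ∀ {Γ m} → Formula τ Γ m → Formula τ Γ m
  _∧ᶠ_  : ∀ {Γ m} → Formula τ Γ m → Formula τ Γ m → Formula τ Γ m
  _∨ᶠ_  : ∀ {Γ m} → Formula τ Γ m → Formula τ Γ m → Formula τ Γ m
  ∃¹    : ∀ {Γ m} → Formula τ Γ (suc m) → Formula τ Γ m
  ∀¹    : ∀ {Γ m} → Formula τ Γ (suc m) → Formula τ Γ m
  ∃²    : ∀ {Γ m} (a : ℕ) → Formula τ (a ∷ Γ) m → Formula τ Γ m
  ∀²    : ∀ {Γ m} (a : ℕ) → Formula τ (a ∷ Γ) m → Formula τ Γ m

Sentence : Signature → Set
Sentence τ = Formula τ [] 0

Relation : Set → ℕ → Set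
Relation D a = Vec D a → Bool

data SEnv (D : Set) : List ℕ → Set where
  []  : SEnv D []
  _∷_ : ∀ {a Γ} → Relation D a → SEnv D Γ → SEnv D (a ∷ Γ)

lookupS : ∀ {D Γ a} → SEnv D Γ → SVar Γ a → Relation D a
lookupS (S ∷ σ) here      = S
lookupS (S ∷ σ) (there v) = lookupS σ v

extend : ∀ {D : Set} {m} → D → (Fin m → D) → Fin (suc m) → D
extend d ρ zero    = d
extend d ρ (suc i) = ρ i

Sat : ∀ {τ Γ m} (A : Structure τ) → Formula τ Γ m →
      SEnv (Dom A) Γ → (Fin m → Dom A) → Set
Sat A (rel R xs)  σ ρ = T (interp A R (map ρ xs))
Sat A (svar v xs) σ ρ = T (lookupS σ v (map ρ xs))
Sat A (equ x y)   σ ρ = ρ x ≡ ρ y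
Sat A (neg φ)     σ ρ = ¬ Sat A φ σ ρ
Sat A (φ ∧ᶠ ψ)    σ ρ = Sat A φ σ ρ × Sat A ψ σ ρ
Sat A (φ ∨ᶠ ψ)    σ ρ = Sat A φ σ ρ ⊎ Sat A ψ σ ρ
Sat A (∃¹ φ)      σ ρ = Σ (Dom A) λ d → Sat A φ σ (extend d ρ)
Sat A (∀¹ φ)      σ ρ = (d : Dom A) → Sat A φ σ (extend d ρ)
Sat A (∃² a φ)    σ ρ = Σ (Relation (Dom A) a) λ S → Sat A φ (S ∷ σ) ρ
Sat A (∀² a φ)    σ ρ = (S : Relation (Dom A) a) → Sat A φ (S ∷ σ) ρ

noVars : {D : Set} → Fin 0 → D
noVars ()

_⊨_ : ∀ {τ} → Structure τ → Sentence τ → Set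
A ⊨ Φ = Sat A Φ [] noVars

Equivalent : ∀ {τ} → Sentence τ → Sentence τ → Set
Equivalent {τ} Φ Ψ = (A : Structure τ) → (A ⊨ Φ) ⇔ (A ⊨ Ψ)

PreservedUnderBijHom : ∀ {τ} → Sentence τ → Set
PreservedUnderBijHom {τ} Φ = (A B : Structure τ) (h : Dom A → Dom B) →
  IsHom A B h → Bijective _≡_ _≡_ h → A ⊨ Φ → B ⊨ Φ

data QF {τ Γ m} : Formula τ Γ m → Set where
  rel  : ∀ R xs → QF (rel R xs)
  svar : ∀ {a} (v : SVar Γ a) xs → QF (svar v xs)
  equ  : ∀ x y → QF (equ x y)
  neg  : ∀ {φ} → QF φ → QF (neg φ)
  and  : ∀ {φ ψ} → QF φ → QF ψ → QF (φ ∧ᶠ ψ)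
  or   : ∀ {φ ψ} → QF φ → QF ψ → QF (φ ∨ᶠ ψ)

data _⟶_ {τ Γ m} : Formula τ Γ m → Formula τ Γ m → Set where
  dm-∧   : ∀ {φ ψ} → neg (φ ∧ᶠ ψ) ⟶ (neg φ ∨ᶠ neg ψ)
  dm-∨   : ∀ {φ ψ} → neg (φ ∨ᶠ ψ) ⟶ (neg φ ∧ᶠ neg ψ)
  dm-¬¬  : ∀ {φ} → neg (neg φ) ⟶ φ
  dist-∨ˡ : ∀ {φ ψ χ} → (φ ∨ᶠ (ψ ∧ᶠ χ)) ⟶ ((φ ∨ᶠ ψ) ∧ᶠ (φ ∨ᶠ χ))
  dist-∨ʳ : ∀ {φ ψ χ} → ((ψ ∧ᶠ χ) ∨ᶠ φ) ⟶ ((ψ ∨ᶠ φ) ∧ᶠ (χ ∨ᶠ φ))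
  dist-∧ˡ : ∀ {φ ψ χ} → (φ ∧ᶠ (ψ ∨ᶠ χ)) ⟶ ((φ ∧ᶠ ψ) ∨ᶠ (φ ∧ᶠ χ))
  dist-∧ʳ : ∀ {φ ψ χ} → ((ψ ∨ᶠ χ) ∧ᶠ φ) ⟶ ((ψ ∧ᶠ φ) ∨ᶠ (χ ∧ᶠ φ))
  cong-neg : ∀ {φ φ'} → φ ⟶ φ' → neg φ ⟶ neg φ'
  cong-∧ˡ  : ∀ {φ φ' ψ} → φ ⟶ φ' → (φ ∧ᶠ ψ) ⟶ (φ' ∧ᶠ ψ)
  cong-∧ʳ  : ∀ {φ ψ ψ'} → ψ ⟶ ψ' → (φ ∧ᶠ ψ) ⟶ (φ ∧ᶠ ψ')
  cong-∨ˡ  : ∀ {φ φ' ψ} → φ ⟶ φ' → (φ ∨ᶠ ψ) ⟶ (φ' ∨ᶠ ψ)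
  cong-∨ʳ  : ∀ {φ ψ ψ'} → ψ ⟶ ψ' → (φ ∨ᶠ ψ) ⟶ (φ ∨ᶠ ψ')

_≈DM_ : ∀ {τ Γ m} → Formula τ Γ m → Formula τ Γ m → Set
_≈DM_ = EqClosure _⟶_

data PosLiteral {τ Γ m} : Formula τ Γ m → Set where
  rel⁺  : ∀ R xs → PosLiteral (rel R xs)
  svar⁺ : ∀ {a} (v : SVar Γ a) xs → PosLiteral (svar v xs)
  svar⁻ : ∀ {a} (v : SVar Γ a) xs → PosLiteral (neg (svar v xs))
  equ⁺  : ∀ x y → PosLiteral (equ x y)
  equ⁻  : ∀ x y → PosLiteral (neg (equ x y))

data PosClause {τ Γ m} : Formula τ Γ m → Set where
  lit : ∀ {φ} → PosLiteral φ → PosClause φ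
  or  : ∀ {φ ψ} → PosClause φ → PosClause ψ → PosClause (φ ∨ᶠ ψ)

data PosCNF {τ Γ m} : Formula τ Γ m → Set where
  clause : ∀ {φ} → PosClause φ → PosCNF φ
  and    : ∀ {φ ψ} → PosCNF φ → PosCNF ψ → PosCNF (φ ∧ᶠ ψ)

data PosMatrix {τ Γ m} (φ : Formula τ Γ m) : Set where
  pos : QF φ → (ψ : Formula τ Γ m) → φ ≈DM ψ → PosCNF ψ → PosMatrix φ

data PosFOPart {τ Γ} : ∀ {m} → Formula τ Γ m → Set where
  matrix : ∀ {m} {φ : Formula τ Γ m} → PosMatrix φ → PosFOPart φ
  ∃¹     : ∀ {m} {φ : Formula τ Γ (suc m)} → PosFOPart φ → PosFOPart (∃¹ φ)
  ∀¹     : ∀ {m} {φ : Formula τ Γ (suc m)} → PosFOPart φ → PosFOPart (∀¹ φ)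

data PosNormalized {τ} : ∀ {Γ m} → Formula τ Γ m → Set where
  fo : ∀ {Γ m} {φ : Formula τ Γ m} → PosFOPart φ → PosNormalized φ
  ∃² : ∀ {Γ m} a {φ : Formula τ (a ∷ Γ) m} → PosNormalized φ → PosNormalized (∃² a φ)
  ∀² : ∀ {Γ m} a {φ : Formula τ (a ∷ Γ) m} → PosNormalized φ → PosNormalized (∀² a φ)

data Quant : Set where
  ∃q ∀q : Quant

SOPrefix : Set
SOPrefix = List (Quant × ℕ)

inner : List ℕ → SOPrefix → List ℕ
inner Γ []            = Γ
inner Γ ((q , a) ∷ P) = inner (a ∷ Γ) P

wrap : ∀ {τ Γ m} (P : SOPrefix) → Formula τ (inner Γ P) m → Formula τ Γ m
wrap []             φ = φ
wrap ((∃q , a) ∷ P) φ = ∃² a (wrap P φ)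
wrap ((∀q , a) ∷ P) φ = ∀² a (wrap P φ)

data PositiveSO {τ} : Sentence τ → Set where
  normalized : ∀ {Φ} → PosNormalized Φ → PositiveSO Φ
  conj : (P : SOPrefix) (φ₁ φ₂ : Formula τ (inner [] P) 0) →
         PositiveSO (wrap P φ₁) → PositiveSO (wrap P φ₂) →
         PositiveSO (wrap P (φ₁ ∧ᶠ φ₂))
  disj : (P : SOPrefix) (φ₁ φ₂ : Formula τ (inner [] P) 0) →
         PositiveSO (wrap P φ₁) → PositiveSO (wrap P φ₂) →
         PositiveSO (wrap P (φ₁ ∨ᶠ φ₂))

-- (2) ⇒ (1): a bijective homomorphism h transports relations exactly
-- (S ↦ S ∘ h⁻¹), so it commutes with second-order quantifiers and with
-- literals of second-order variables of either sign; positive τ-atoms are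
-- carried along because h is a homomorphism, negated equalities because h is
-- injective, and first-order ∀ because h is surjective.
--
-- (1) ⇒ (2): Φ is equivalent to Ψ = ∃(S_R)_R. ⋀_R ∀x̄ (¬ S_R x̄ ∨ R x̄) ∧ Φ[S_R/R].
-- If A ⊨ Φ take S_R = R^A; conversely the identity is a bijective
-- homomorphism from (A with the S_R) to A. As Φ[S_R/R] has no τ-atoms, every
-- prenex CNF of Ψ is positive. Prenexing is sound because satisfaction on
-- finite structures is decidable (so the classical quantifier laws hold), and
-- a second-order quantifier moves outside a first-order one by taking the
-- first-order variable as an extra argument.

module Submission where

open import Defs
open import Data.Nat using (ℕ; zero; suc; _+_)
open import Data.Fin using (Fin; zero; suc; lift)
open import Data.Fin.Properties using (any?; all?) renaming (_≟_ to _≟ᶠ_)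
open import Data.Bool using (Bool; true; false; T; not)
open import Data.Vec using (Vec; []; _∷_; map; _++_; allFin; lookup)
open import Data.Vec.Properties
  using (map-++; map-∘; map-cong; map-id; tabulate-allFin; tabulate-cong; tabulate∘lookup)
open import Data.List using (List; []; _∷_; tabulate)
open import Data.Product using (Σ; ∃; _×_; _,_; proj₁; proj₂) renaming (map to mapΣ)
open import Data.Product.Function.NonDependent.Propositional using (_×-⇔_)
open import Data.Sum using (_⊎_; inj₁; inj₂; [_,_]) renaming (map to map⊎)
open import Data.Sum.Function.Propositional using (_⊎-⇔_)
open import Data.Empty using (⊥-elim)
open import Function using (_∘_; id)
open import Function.Bundles using (_⇔_; mk⇔; Equivalence; Inverse; mk⤖)
open import Function.Definitions using (Bijective)
open import Function.Construct.Identity using (⇔-id; bijective)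
open import Function.Construct.Symmetry using (⇔-sym)
import Function.Construct.Composition as Composition
open import Function.Related.TypeIsomorphisms using (¬-cong-⇔; ×-distribˡ-⊎; ×-distribʳ-⊎)
open import Function.Properties.Equivalence using (⇔-isEquivalence)
open import Function.Properties.Inverse using (↔⇒⇔)
open import Function.Properties.Bijection using (⤖⇒↔)
open import Relation.Nullary using (¬_; Dec; yes; no)
open import Relation.Nullary.Decidable using (decidable-stable; _×-dec_; _⊎-dec_; ¬?; T?; map′)
open import Relation.Nullary.Negation using (¬∃⟶∀¬; ∀¬⟶¬∃; ∃¬⟶¬∀)
open import Relation.Binary.Construct.Closure.Equivalence using (gfold; gmap)
open import Relation.Binary.Construct.Closure.ReflexiveTransitive using (ε; _◅_; _◅◅_)
open import Relation.Binary.Construct.Closure.Symmetric using (fwd)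
open import Relation.Binary.PropositionalEquality
  using (_≡_; _≗_; refl; sym; trans; cong; subst; module ≡-Reasoning)

private variable
  τ : Signature
  Γ Δ : List ℕ
  m n : ℕ
  I : Set
  X X′ Y Y′ Z : Set

open Equivalence using (to; from)

infixr 4 _⨾_
_⨾_ : X ⇔ Y → Y ⇔ Y′ → X ⇔ Y′
_⨾_ = Composition.equivalence

≡⇒⇔ : X ≡ Y → X ⇔ Y
≡⇒⇔ refl = ⇔-id _

data Conn : Set where
  ∧ᶜ ∨ᶜ : Conn

joinᶠ : Conn → Formula τ Γ m → Formula τ Γ m → Formula τ Γ m
joinᶠ ∧ᶜ φ ψ = φ ∧ᶠ ψ
joinᶠ ∨ᶜ φ ψ = φ ∨ᶠ ψ

Join : Conn → Set → Set → Set
Join ∧ᶜ X Y = X × Y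
Join ∨ᶜ X Y = X ⊎ Y

Join-cong : ∀ c → X ⇔ X′ → Y ⇔ Y′ → Join c X Y ⇔ Join c X′ Y′
Join-cong ∧ᶜ = _×-⇔_
Join-cong ∨ᶜ = _⊎-⇔_

Join-comm : ∀ c → Join c X Y ⇔ Join c Y X
Join-comm ∧ᶜ = mk⇔ (λ (x , y) → y , x) (λ (y , x) → x , y)
Join-comm ∨ᶜ = mk⇔ [ inj₂ , inj₁ ] [ inj₂ , inj₁ ]

⊎-distribˡ-× : (X ⊎ (Y × Z)) ⇔ ((X ⊎ Y) × (X ⊎ Z))
⊎-distribˡ-× = mk⇔
  [ (λ x → inj₁ x , inj₁ x) , (λ (y , z) → inj₂ y , inj₂ z) ]
  (λ { (inj₁ x , _) → inj₁ x ; (_ , inj₁ x) → inj₁ x ; (inj₂ y , inj₂ z) → inj₂ (y , z) })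

⊎-distribʳ-× : ((Y × Z) ⊎ X) ⇔ ((Y ⊎ X) × (Z ⊎ X))
⊎-distribʳ-× = Join-comm ∨ᶜ ⨾ ⊎-distribˡ-× ⨾ (Join-comm ∨ᶜ ×-⇔ Join-comm ∨ᶜ)

Quantify : Quant → (I : Set) → (I → Set) → Set
Quantify ∃q I X = Σ I X
Quantify ∀q I X = (i : I) → X i

Quantify-cong : ∀ q {X X′ : I → Set} → (∀ i → X i ⇔ X′ i) → Quantify q I X ⇔ Quantify q I X′
Quantify-cong ∃q e = mk⇔ (λ (i , x) → i , to (e i) x) (λ (i , x) → i , from (e i) x)
Quantify-cong ∀q e = mk⇔ (λ f i → to (e i) (f i)) (λ f i → from (e i) (f i))

-- Pulling a quantifier out of an operand needs a witness of the (nonempty)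
-- index type, and for ∀ over ∨ the excluded middle for the other operand.
prenexˡ : ∀ q c {X : I → Set} → I → Dec Y →
  Quantify q I (λ i → Join c (X i) Y) ⇔ Join c (Quantify q I X) Y
prenexˡ ∃q ∧ᶜ i₀ Y? = mk⇔ (λ (i , x , y) → (i , x) , y) (λ ((i , x) , y) → i , x , y)
prenexˡ ∃q ∨ᶜ i₀ Y? = mk⇔
  (λ { (i , inj₁ x) → inj₁ (i , x) ; (i , inj₂ y) → inj₂ y })
  [ (λ (i , x) → i , inj₁ x) , (λ y → i₀ , inj₂ y) ]
prenexˡ ∀q ∧ᶜ i₀ Y? = mk⇔ (λ f → proj₁ ∘ f , proj₂ (f i₀)) (λ (f , y) i → f i , y)
prenexˡ ∀q ∨ᶜ i₀ (yes y) = mk⇔ (λ _ → inj₂ y) (λ _ i → inj₂ y)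
prenexˡ ∀q ∨ᶜ i₀ (no ¬y) = mk⇔
  (λ f → inj₁ λ i → [ id , ⊥-elim ∘ ¬y ] (f i))
  [ (λ f i → inj₁ (f i)) , (λ y i → inj₂ y) ]

prenexʳ : ∀ q c {X : I → Set} → I → Dec Y →
  Quantify q I (λ i → Join c Y (X i)) ⇔ Join c Y (Quantify q I X)
prenexʳ q c i₀ Y? = Quantify-cong q (λ i → Join-comm c) ⨾ prenexˡ q c i₀ Y? ⨾ Join-comm c

¬∃¬⟶∀ : {X : I → Set} → (∀ i → Dec (X i)) → ¬ (∃ λ i → ¬ X i) → ∀ i → X i
¬∃¬⟶∀ X? ¬∃¬X i = decidable-stable (X? i) λ ¬x → ¬∃¬X (i , ¬x)

¬∀⟶∃¬ : {X : I → Set} → Dec (∃ λ i → ¬ X i) → (∀ i → Dec (X i)) → ¬ (∀ i → X i) → ∃ λ i → ¬ X i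
¬∀⟶∃¬ (yes ∃¬X) X? ¬∀X = ∃¬X
¬∀⟶∃¬ (no ¬∃¬X) X? ¬∀X = ⊥-elim (¬∀X (¬∃¬⟶∀ X? ¬∃¬X))

∀-dec : {X : I → Set} → Dec (∃ λ i → ¬ X i) → (∀ i → Dec (X i)) → Dec (∀ i → X i)
∀-dec (yes (i , ¬x)) X? = no λ ∀X → ¬x (∀X i)
∀-dec (no ¬∃¬X)      X? = yes (¬∃¬⟶∀ X? ¬∃¬X)

Polarized : Bool → Set → Set
Polarized true  X = X
Polarized false X = ¬ X

polarᶜ : Bool → Conn → Conn
polarᶜ true  c  = c
polarᶜ false ∧ᶜ = ∨ᶜ
polarᶜ false ∨ᶜ = ∧ᶜ

polarᵠ : Bool → Quant → Quant
polarᵠ true  q  = q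
polarᵠ false ∃q = ∀q
polarᵠ false ∀q = ∃q

Polarized-cong : ∀ b → X ⇔ Y → Polarized b X ⇔ Polarized b Y
Polarized-cong true  = id
Polarized-cong false = ¬-cong-⇔

Polarized-not : ∀ b → Dec X → Polarized (not b) X ⇔ Polarized b (¬ X)
Polarized-not true  X? = ⇔-id _
Polarized-not false X? = mk⇔ (λ x ¬x → ¬x x) (decidable-stable X?)

Join-polarized : ∀ b c → Dec X →
  Join (polarᶜ b c) (Polarized b X) (Polarized b Y) ⇔ Polarized b (Join c X Y)
Join-polarized true  c  X? = ⇔-id _
Join-polarized false ∧ᶜ X? =
  mk⇔ (λ ¬x⊎¬y (x , y) → [ (λ ¬x → ¬x x) , (λ ¬y → ¬y y) ] ¬x⊎¬y) (deMorgan X?)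
  where
  deMorgan : Dec X → ¬ (X × Y) → ¬ X ⊎ ¬ Y
  deMorgan (yes x) ¬xy = inj₂ λ y → ¬xy (x , y)
  deMorgan (no ¬x) ¬xy = inj₁ ¬x
Join-polarized false ∨ᶜ X? = mk⇔ (λ (¬x , ¬y) → [ ¬x , ¬y ]) (λ ¬x⊎y → ¬x⊎y ∘ inj₁ , ¬x⊎y ∘ inj₂)

Quantify-polarized : ∀ b q {X : I → Set} → Dec (∃ λ i → ¬ X i) → (∀ i → Dec (X i)) →
  Quantify (polarᵠ b q) I (Polarized b ∘ X) ⇔ Polarized b (Quantify q I X)
Quantify-polarized true  q  ∃¬X? X? = ⇔-id _
Quantify-polarized false ∃q ∃¬X? X? = mk⇔ ∀¬⟶¬∃ ¬∃⟶∀¬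
Quantify-polarized false ∀q ∃¬X? X? = mk⇔ ∃¬⟶¬∀ (¬∀⟶∃¬ ∃¬X? X?)

uncurryᴿ : ∀ {D : Set} {a} → (D → Relation D a) → Relation D (suc a)
uncurryᴿ F (d ∷ t) = F d t

-- Skolemisation for relations; only the ∀S′ ∃d case needs decidability.
Quantify-skolem : ∀ q′ q {D : Set} {a} (X : D → Relation D a → Set) →
  Dec (∃ λ d → ∀ S → X d S) → (∀ d → Dec (∃ λ S → ¬ X d S)) → (∀ d S → Dec (X d S)) →
  Quantify q′ (Relation D (suc a)) (λ S′ → Quantify q D (λ d → X d (λ t → S′ (d ∷ t))))
  ⇔ Quantify q D (λ d → Quantify q′ (Relation D a) (X d))
Quantify-skolem ∃q ∃q X _ _ _ =
  mk⇔ (λ (S′ , d , x) → d , _ , x) (λ (d , S , x) → uncurryᴿ (λ _ → S) , d , x)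
Quantify-skolem ∀q ∀q X _ _ _ = mk⇔ (λ f d S → f (uncurryᴿ λ _ → S) d) (λ f S′ d → f d _)
Quantify-skolem ∃q ∀q X _ _ _ =
  mk⇔ (λ (S′ , f) d → _ , f d) (λ f → uncurryᴿ (proj₁ ∘ f) , proj₂ ∘ f)
Quantify-skolem ∀q ∃q X ∃∀X? ∃¬X? X? = mk⇔ (choose ∃∀X?) (λ (d , f) S′ → d , f _)
  where
  choose : Dec (∃ λ d → ∀ S → X d S) →
    (∀ S′ → ∃ λ d → X d (λ t → S′ (d ∷ t))) → ∃ λ d → ∀ S → X d S
  choose (yes ∃∀X) f = ∃∀X
  choose (no ¬∃∀X) f =
    let (d , x) = f (uncurryᴿ (proj₁ ∘ counterexample)) in ⊥-elim (proj₂ (counterexample d) x)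
    where
    counterexample : ∀ d → ∃ λ S → ¬ X d S
    counterexample d = ¬∀⟶∃¬ (∃¬X? d) (X? d) λ ∀X → ¬∃∀X (d , ∀X)

-- A variable of arity a may be replaced by a variable of arity k + a whose
-- first k arguments are fixed first-order variables.
record Applied (Δ : List ℕ) (n a : ℕ) : Set where
  constructor applied
  field
    {#fixed} : ℕ
    var      : SVar Δ (#fixed + a)
    fixed    : Vec (Fin n) #fixed
open Applied

SOSub : List ℕ → List ℕ → ℕ → Set
SOSub Γ Δ n = ∀ {a} → SVar Γ a → Applied Δ n a

liftᶠ : SOSub Γ Δ n → SOSub Γ Δ (suc n)
liftᶠ f v = applied (var (f v)) (map suc (fixed (f v)))

liftˢ : ∀ {a} → SOSub Γ Δ n → SOSub (a ∷ Γ) (a ∷ Δ) n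
liftˢ f here      = applied {#fixed = 0} here []
liftˢ f (there v) = applied (there (var (f v))) (fixed (f v))

idˢ : SOSub Γ Γ n
idˢ v = applied {#fixed = 0} v []

wkˢ : ∀ {a} → SOSub Γ (a ∷ Γ) n
wkˢ v = applied {#fixed = 0} (there v) []

sub : SOSub Γ Δ n → (Fin m → Fin n) → Formula τ Γ m → Formula τ Δ n
sub f g (rel R xs)  = rel R (map g xs)
sub f g (svar v xs) = svar (var (f v)) (fixed (f v) ++ map g xs)
sub f g (equ x y)   = equ (g x) (g y)
sub f g (neg φ)     = neg (sub f g φ)
sub f g (φ ∧ᶠ ψ)    = sub f g φ ∧ᶠ sub f g ψ
sub f g (φ ∨ᶠ ψ)    = sub f g φ ∨ᶠ sub f g ψ
sub f g (∃¹ φ)      = ∃¹ (sub (liftᶠ f) (lift 1 g) φ)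
sub f g (∀¹ φ)      = ∀¹ (sub (liftᶠ f) (lift 1 g) φ)
sub f g (∃² a φ)    = ∃² a (sub (liftˢ f) g φ)
sub f g (∀² a φ)    = ∀² a (sub (liftˢ f) g φ)

record Agrees {D : Set} (f : SOSub Γ Δ n) (σ′ : SEnv D Δ) (ρ′ : Fin n → D) (σ : SEnv D Γ) :
              Set where
  constructor agrees
  field
    lookup-agrees : ∀ {a} (v : SVar Γ a) t →
      lookupS σ′ (var (f v)) (map ρ′ (fixed (f v)) ++ t) ≡ lookupS σ v t
open Agrees

module _ {D : Set} {f : SOSub Γ Δ n} {σ′ : SEnv D Δ} {ρ′ : Fin n → D} {σ : SEnv D Γ} where

  Agrees-liftᶠ : ∀ {d} → Agrees f σ′ ρ′ σ → Agrees (liftᶠ f) σ′ (extend d ρ′) σ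
  Agrees-liftᶠ {d} agree = agrees λ v t → trans
    (cong (λ u → lookupS σ′ (var (f v)) (u ++ t)) (sym (map-∘ (extend d ρ′) suc (fixed (f v)))))
    (lookup-agrees agree v t)

  Agrees-liftˢ : ∀ {a} {S : Relation D a} → Agrees f σ′ ρ′ σ → Agrees (liftˢ f) (S ∷ σ′) ρ′ (S ∷ σ)
  Agrees-liftˢ agree = agrees λ { here t → refl ; (there v) t → lookup-agrees agree v t }

map-reindex : ∀ {D : Set} {g : Fin m → Fin n} {ρ′ : Fin n → D} {ρ : Fin m → D} →
  (∀ i → ρ′ (g i) ≡ ρ i) → ∀ {a} (xs : Vec (Fin m) a) → map ρ′ (map g xs) ≡ map ρ xs
map-reindex {g = g} {ρ′} reindex xs = trans (sym (map-∘ ρ′ g xs)) (map-cong reindex xs)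

sub-sat : (A : Structure τ) (f : SOSub Γ Δ n) (g : Fin m → Fin n) (φ : Formula τ Γ m)
  {σ′ : SEnv (Dom A) Δ} {ρ′ : Fin n → Dom A} {σ : SEnv (Dom A) Γ} {ρ : Fin m → Dom A} →
  Agrees f σ′ ρ′ σ → (∀ i → ρ′ (g i) ≡ ρ i) →
  Sat A (sub f g φ) σ′ ρ′ ⇔ Sat A φ σ ρ
sub-sat A f g (rel R xs) agree reindex = ≡⇒⇔ (cong (T ∘ interp A R) (map-reindex reindex xs))
sub-sat A f g (svar v xs) {σ′} {ρ′} {σ} {ρ} agree reindex = ≡⇒⇔ (cong T (begin
  lookupS σ′ (var (f v)) (map ρ′ (fixed (f v) ++ map g xs))
    ≡⟨ cong (lookupS σ′ (var (f v))) (map-++ ρ′ (fixed (f v)) (map g xs)) ⟩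
  lookupS σ′ (var (f v)) (map ρ′ (fixed (f v)) ++ map ρ′ (map g xs))
    ≡⟨ cong (λ u → lookupS σ′ (var (f v)) (map ρ′ (fixed (f v)) ++ u)) (map-reindex reindex xs) ⟩
  lookupS σ′ (var (f v)) (map ρ′ (fixed (f v)) ++ map ρ xs)
    ≡⟨ lookup-agrees agree v (map ρ xs) ⟩
  lookupS σ v (map ρ xs) ∎))
  where open ≡-Reasoning
sub-sat A f g (equ x y) agree reindex =
  mk⇔ (λ e → trans (sym (reindex x)) (trans e (reindex y)))
      (λ e → trans (reindex x) (trans e (sym (reindex y))))
sub-sat A f g (neg φ)  agree reindex = ¬-cong-⇔ (sub-sat A f g φ agree reindex)
sub-sat A f g (φ ∧ᶠ ψ) agree reindex =
  sub-sat A f g φ agree reindex ×-⇔ sub-sat A f g ψ agree reindex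
sub-sat A f g (φ ∨ᶠ ψ) agree reindex =
  sub-sat A f g φ agree reindex ⊎-⇔ sub-sat A f g ψ agree reindex
sub-sat A f g (∃¹ φ) agree reindex = Quantify-cong ∃q λ d →
  sub-sat A (liftᶠ f) (lift 1 g) φ (Agrees-liftᶠ agree) λ { zero → refl ; (suc i) → reindex i }
sub-sat A f g (∀¹ φ) agree reindex = Quantify-cong ∀q λ d →
  sub-sat A (liftᶠ f) (lift 1 g) φ (Agrees-liftᶠ agree) λ { zero → refl ; (suc i) → reindex i }
sub-sat A f g (∃² a φ) agree reindex = Quantify-cong ∃q λ S →
  sub-sat A (liftˢ f) g φ (Agrees-liftˢ agree) reindex
sub-sat A f g (∀² a φ) agree reindex = Quantify-cong ∀q λ S →
  sub-sat A (liftˢ f) g φ (Agrees-liftˢ agree) reindex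

wkᶠ : Formula τ Γ m → Formula τ Γ (suc m)
wkᶠ = sub idˢ suc

wkᶠ-sat : (A : Structure τ) (φ : Formula τ Γ m) → ∀ {σ ρ d} →
  Sat A (wkᶠ φ) σ (extend d ρ) ⇔ Sat A φ σ ρ
wkᶠ-sat A φ = sub-sat A idˢ suc φ (agrees λ v t → refl) (λ i → refl)

wkˢ-sat : (A : Structure τ) (φ : Formula τ Γ m) → ∀ {a} {S : Relation (Dom A) a} {σ ρ} →
  Sat A (sub wkˢ id φ) (S ∷ σ) ρ ⇔ Sat A φ σ ρ
wkˢ-sat A φ = sub-sat A wkˢ id φ (agrees λ v t → refl) (λ i → refl)

module _ (f : SOSub Γ Δ n) (g : Fin m → Fin n) where

  sub-QF : {φ : Formula τ Γ m} → QF φ → QF (sub f g φ)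
  sub-QF (rel R xs)  = rel R _
  sub-QF (svar v xs) = svar _ _
  sub-QF (equ x y)   = equ _ _
  sub-QF (neg q)     = neg (sub-QF q)
  sub-QF (and q r)   = and (sub-QF q) (sub-QF r)
  sub-QF (or q r)    = or (sub-QF q) (sub-QF r)

  sub-⟶ : {φ ψ : Formula τ Γ m} → φ ⟶ ψ → sub f g φ ⟶ sub f g ψ
  sub-⟶ dm-∧         = dm-∧
  sub-⟶ dm-∨         = dm-∨
  sub-⟶ dm-¬¬        = dm-¬¬
  sub-⟶ dist-∨ˡ      = dist-∨ˡ
  sub-⟶ dist-∨ʳ      = dist-∨ʳ
  sub-⟶ dist-∧ˡ      = dist-∧ˡ
  sub-⟶ dist-∧ʳ      = dist-∧ʳ
  sub-⟶ (cong-neg s) = cong-neg (sub-⟶ s)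
  sub-⟶ (cong-∧ˡ s)  = cong-∧ˡ (sub-⟶ s)
  sub-⟶ (cong-∧ʳ s)  = cong-∧ʳ (sub-⟶ s)
  sub-⟶ (cong-∨ˡ s)  = cong-∨ˡ (sub-⟶ s)
  sub-⟶ (cong-∨ʳ s)  = cong-∨ʳ (sub-⟶ s)

  sub-literal : {φ : Formula τ Γ m} → PosLiteral φ → PosLiteral (sub f g φ)
  sub-literal (rel⁺ R xs)  = rel⁺ _ _
  sub-literal (svar⁺ v xs) = svar⁺ _ _
  sub-literal (svar⁻ v xs) = svar⁻ _ _
  sub-literal (equ⁺ x y)   = equ⁺ _ _
  sub-literal (equ⁻ x y)   = equ⁻ _ _

  sub-clause : {φ : Formula τ Γ m} → PosClause φ → PosClause (sub f g φ)
  sub-clause (lit l)  = lit (sub-literal l)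
  sub-clause (or c d) = or (sub-clause c) (sub-clause d)

  sub-cnf : {φ : Formula τ Γ m} → PosCNF φ → PosCNF (sub f g φ)
  sub-cnf (clause c) = clause (sub-clause c)
  sub-cnf (and c d)  = and (sub-cnf c) (sub-cnf d)

  sub-matrix : {φ : Formula τ Γ m} → PosMatrix φ → PosMatrix (sub f g φ)
  sub-matrix (pos q ψ φ≈ψ cnf) =
    pos (sub-QF q) (sub f g ψ) (gmap (sub f g) sub-⟶ φ≈ψ) (sub-cnf cnf)

sub-foPart : (f : SOSub Γ Δ n) (g : Fin m → Fin n) {φ : Formula τ Γ m} →
  PosFOPart φ → PosFOPart (sub f g φ)
sub-foPart f g (matrix p) = matrix (sub-matrix f g p)
sub-foPart f g (∃¹ p)     = ∃¹ (sub-foPart (liftᶠ f) (lift 1 g) p)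
sub-foPart f g (∀¹ p)     = ∀¹ (sub-foPart (liftᶠ f) (lift 1 g) p)

liftᴾ : (P : SOPrefix) → SOSub Γ Δ n → SOSub (inner Γ P) (inner Δ P) n
liftᴾ []            f = f
liftᴾ ((q , a) ∷ P) f = liftᴾ P (liftˢ f)

sub-wrap : (P : SOPrefix) (f : SOSub Γ Δ n) (g : Fin m → Fin n) (φ : Formula τ (inner Γ P) m) →
  sub f g (wrap P φ) ≡ wrap P (sub (liftᴾ P f) g φ)
sub-wrap []             f g φ = refl
sub-wrap ((∃q , a) ∷ P) f g φ = cong (∃² a) (sub-wrap P (liftˢ f) g φ)
sub-wrap ((∀q , a) ∷ P) f g φ = cong (∀² a) (sub-wrap P (liftˢ f) g φ)

Sat-resp-lookup : (A : Structure τ) (φ : Formula τ Γ m)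
  {σ σ′ : SEnv (Dom A) Γ} {ρ : Fin m → Dom A} →
  (∀ {a} (v : SVar Γ a) → lookupS σ v ≗ lookupS σ′ v) → Sat A φ σ ρ → Sat A φ σ′ ρ
Sat-resp-lookup A φ {σ} {σ′} σ≗σ′ =
  to (sub-sat A idˢ id φ {σ′ = σ′} (agrees λ v t → refl) (λ i → refl))
  ∘ from (sub-sat A idˢ id φ {σ′ = σ′} (agrees λ v t → sym (σ≗σ′ v t)) (λ i → refl))

-- Functions are compared pointwise, so a search may only be asked for
-- predicates that respect the given equivalence.
Searchable : (X : Set) → (X → X → Set) → Set₁
Searchable X _≈_ = (P : X → Set) → (∀ {x y} → x ≈ y → P x → P y) → (∀ x → Dec (P x)) → Dec (∃ P)

Bool-searchable : Searchable Bool _≡_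
Bool-searchable P resp P? with P? true | P? false
... | yes p | _     = yes (true , p)
... | no _  | yes p = yes (false , p)
... | no ¬t | no ¬f = no λ { (true , p) → ¬t p ; (false , p) → ¬f p }

Π-searchable : {_≈_ : X → X → Set} → (∀ {x} → x ≈ x) → Searchable X _≈_ →
  ∀ n → Searchable (Fin n → X) (λ f g → ∀ i → f i ≈ g i)
Π-searchable ≈-refl searchX zero P resp P? =
  map′ (λ p → noVars , p) (λ (f , p) → resp (λ ()) p) (P? noVars)
Π-searchable {X = X} {_≈_} ≈-refl searchX (suc n) P resp P? =
  map′ (λ (x , f , p) → extend x f , p) (λ (f , p) → f zero , f ∘ suc , resp η p)
    (searchX (λ x → ∃ λ f → P (extend x f))
      (λ x≈y (f , p) → f , resp (λ { zero → x≈y ; (suc i) → ≈-refl }) p)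
      (λ x → Π-searchable ≈-refl searchX n (P ∘ extend x)
        (λ f≈g → resp λ { zero → ≈-refl ; (suc i) → f≈g i }) (P? ∘ extend x)))
  where
  η : ∀ {f : Fin (suc n) → X} i → f i ≈ extend (f zero) (f ∘ suc) i
  η zero    = ≈-refl
  η (suc i) = ≈-refl

retract-searchable : {_≈_ : X → X → Set} {_∼_ : Y → Y → Set} → Searchable X _≈_ →
  (f : X → Y) (g : Y → X) → (∀ {x x′} → x ≈ x′ → f x ∼ f x′) → (∀ y → y ∼ f (g y)) →
  Searchable Y _∼_
retract-searchable searchX f g f-cong section P resp P? =
  map′ (λ (x , p) → f x , p) (λ (y , p) → g y , resp (section y) p)
    (searchX (P ∘ f) (resp ∘ f-cong) (P? ∘ f))

Relation-searchable : ∀ N a → Searchable (Relation (Fin N) a) _≗_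
Relation-searchable N zero = retract-searchable Bool-searchable (λ b _ → b) (λ S → S [])
  (λ { refl [] → refl }) (λ { S [] → refl })
Relation-searchable N (suc a) =
  retract-searchable (Π-searchable (λ _ → refl) (Relation-searchable N a) N)
    uncurryᴿ (λ S d t → S (d ∷ t))
    (λ F≗G → λ { (d ∷ t) → F≗G d t }) (λ { S (d ∷ t) → refl })

sat? : (A : Structure τ) (φ : Formula τ Γ m) (σ : SEnv (Dom A) Γ) (ρ : Fin m → Dom A) →
  Dec (Sat A φ σ ρ)
sat? A (rel R xs)  σ ρ = T? _
sat? A (svar v xs) σ ρ = T? _
sat? A (equ x y)   σ ρ = ρ x ≟ᶠ ρ y
sat? A (neg φ)     σ ρ = ¬? (sat? A φ σ ρ)
sat? A (φ ∧ᶠ ψ)    σ ρ = sat? A φ σ ρ ×-dec sat? A ψ σ ρ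
sat? A (φ ∨ᶠ ψ)    σ ρ = sat? A φ σ ρ ⊎-dec sat? A ψ σ ρ
sat? A (∃¹ φ)      σ ρ = any? λ d → sat? A φ σ (extend d ρ)
sat? A (∀¹ φ)      σ ρ = all? λ d → sat? A φ σ (extend d ρ)
sat? A (∃² a φ)    σ ρ = Relation-searchable _ a (λ S → Sat A φ (S ∷ σ) ρ)
  (λ S≗S′ → Sat-resp-lookup A φ λ { here → S≗S′ ; (there v) t → refl })
  (λ S → sat? A φ (S ∷ σ) ρ)
sat? A (∀² a φ)    σ ρ = ∀-dec
  (Relation-searchable _ a (λ S → ¬ Sat A φ (S ∷ σ) ρ)
    (λ S≗S′ ¬s → ¬s ∘ Sat-resp-lookup A φ λ { here t → sym (S≗S′ t) ; (there v) t → refl })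
    (λ S → ¬? (sat? A φ (S ∷ σ) ρ)))
  (λ S → sat? A φ (S ∷ σ) ρ)

⟶-sound : (A : Structure τ) (σ : SEnv (Dom A) Γ) (ρ : Fin m → Dom A) {φ ψ : Formula τ Γ m} →
  φ ⟶ ψ → Sat A φ σ ρ ⇔ Sat A ψ σ ρ
⟶-sound A σ ρ (dm-∧ {φ}) = ⇔-sym (Join-polarized false ∧ᶜ (sat? A φ σ ρ))
⟶-sound A σ ρ (dm-∨ {φ}) = ⇔-sym (Join-polarized false ∨ᶜ (sat? A φ σ ρ))
⟶-sound A σ ρ (dm-¬¬ {φ}) = ⇔-sym (Polarized-not false (sat? A φ σ ρ))
⟶-sound A σ ρ dist-∨ˡ = ⊎-distribˡ-×
⟶-sound A σ ρ dist-∨ʳ = ⊎-distribʳ-×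
⟶-sound A σ ρ dist-∧ˡ = ↔⇒⇔ ×-distribˡ-⊎
⟶-sound A σ ρ dist-∧ʳ = ↔⇒⇔ ×-distribʳ-⊎
⟶-sound A σ ρ (cong-neg s) = ¬-cong-⇔ (⟶-sound A σ ρ s)
⟶-sound A σ ρ (cong-∧ˡ s)  = ⟶-sound A σ ρ s ×-⇔ ⇔-id _
⟶-sound A σ ρ (cong-∧ʳ s)  = ⇔-id _ ×-⇔ ⟶-sound A σ ρ s
⟶-sound A σ ρ (cong-∨ˡ s)  = ⟶-sound A σ ρ s ⊎-⇔ ⇔-id _
⟶-sound A σ ρ (cong-∨ʳ s)  = ⇔-id _ ⊎-⇔ ⟶-sound A σ ρ s

≈DM-sound : (A : Structure τ) (σ : SEnv (Dom A) Γ) (ρ : Fin m → Dom A) {φ ψ : Formula τ Γ m} →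
  φ ≈DM ψ → Sat A φ σ ρ ⇔ Sat A ψ σ ρ
≈DM-sound A σ ρ = gfold ⇔-isEquivalence (λ φ → Sat A φ σ ρ) (⟶-sound A σ ρ)

module Preservation {A B : Structure τ} (h : Dom A → Dom B) (hom : IsHom A B h)
                    (bij : Bijective _≡_ _≡_ h) where

  open Inverse (⤖⇒↔ (mk⤖ bij))
    using () renaming (from to h⁻¹; strictlyInverseˡ to h∘h⁻¹; strictlyInverseʳ to h⁻¹∘h)

  record Image (σ : SEnv (Dom A) Γ) (ρ : Fin m → Dom A)
               (σ′ : SEnv (Dom B) Γ) (ρ′ : Fin m → Dom B) : Set where
    constructor image
    field
      lookup-image : ∀ {a} (v : SVar Γ a) t → lookupS σ′ v (map h t) ≡ lookupS σ v t
      var-image    : ∀ i → ρ′ i ≡ h (ρ i)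
  open Image public

  Image-extend : ∀ {σ : SEnv (Dom A) Γ} {ρ : Fin m → Dom A} {σ′ ρ′ d d′} →
    d′ ≡ h d → Image σ ρ σ′ ρ′ → Image σ (extend d ρ) σ′ (extend d′ ρ′)
  Image-extend d′≡hd im = image (lookup-image im) λ { zero → d′≡hd ; (suc i) → var-image im i }

  Image-∷ : ∀ {σ : SEnv (Dom A) Γ} {ρ : Fin m → Dom A} {σ′ ρ′ a} {S : Relation (Dom A) a} {S′} →
    (∀ t → S′ (map h t) ≡ S t) → Image σ ρ σ′ ρ′ → Image (S ∷ σ) ρ (S′ ∷ σ′) ρ′
  Image-∷ S′∘h≗S im = image (λ { here → S′∘h≗S ; (there v) → lookup-image im v }) (var-image im)

  record Preserved (φ : Formula τ Γ m) : Set where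
    constructor preserved
    field
      transport : ∀ {σ ρ σ′ ρ′} → Image σ ρ σ′ ρ′ → Sat A φ σ ρ → Sat B φ σ′ ρ′
  open Preserved public

  map-image : ∀ {σ : SEnv (Dom A) Γ} {ρ : Fin m → Dom A} {σ′ ρ′} → Image σ ρ σ′ ρ′ →
    ∀ {a} (xs : Vec (Fin m) a) → map ρ′ xs ≡ map h (map ρ xs)
  map-image {ρ = ρ} im xs = trans (map-cong (var-image im) xs) (map-∘ h ρ xs)

  literal-preserved : {φ : Formula τ Γ m} → PosLiteral φ → Preserved φ
  literal-preserved (rel⁺ R xs) = preserved λ im s →
    subst (T ∘ interp B R) (sym (map-image im xs)) (hom R _ s)
  literal-preserved (svar⁺ v xs) = preserved λ {σ′ = σ′} im s →
    subst T (sym (trans (cong (lookupS σ′ v) (map-image im xs)) (lookup-image im v _))) s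
  literal-preserved (svar⁻ v xs) = preserved λ {σ′ = σ′} im ¬s s′ →
    ¬s (subst T (trans (cong (lookupS σ′ v) (map-image im xs)) (lookup-image im v _)) s′)
  literal-preserved (equ⁺ x y) = preserved λ im x≡y →
    trans (var-image im x) (trans (cong h x≡y) (sym (var-image im y)))
  literal-preserved (equ⁻ x y) = preserved λ im x≢y hx≡hy →
    x≢y (proj₁ bij (trans (sym (var-image im x)) (trans hx≡hy (var-image im y))))

  ∧-preserved : {φ ψ : Formula τ Γ m} → Preserved φ → Preserved ψ → Preserved (φ ∧ᶠ ψ)
  ∧-preserved pφ pψ = preserved λ im (s , t) → transport pφ im s , transport pψ im t

  ∨-preserved : {φ ψ : Formula τ Γ m} → Preserved φ → Preserved ψ → Preserved (φ ∨ᶠ ψ)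
  ∨-preserved pφ pψ = preserved λ im → map⊎ (transport pφ im) (transport pψ im)

  clause-preserved : {φ : Formula τ Γ m} → PosClause φ → Preserved φ
  clause-preserved (lit l)  = literal-preserved l
  clause-preserved (or c d) = ∨-preserved (clause-preserved c) (clause-preserved d)

  cnf-preserved : {φ : Formula τ Γ m} → PosCNF φ → Preserved φ
  cnf-preserved (clause c) = clause-preserved c
  cnf-preserved (and c d)  = ∧-preserved (cnf-preserved c) (cnf-preserved d)

  matrix-preserved : {φ : Formula τ Γ m} → PosMatrix φ → Preserved φ
  matrix-preserved (pos _ ψ φ≈ψ cnf) = preserved λ {σ} {ρ} {σ′} {ρ′} im →
    from (≈DM-sound B σ′ ρ′ φ≈ψ) ∘ transport (cnf-preserved cnf) im ∘ to (≈DM-sound A σ ρ φ≈ψ)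

  ∃¹-preserved : {φ : Formula τ Γ (suc m)} → Preserved φ → Preserved (∃¹ φ)
  ∃¹-preserved pφ = preserved λ im (d , s) → h d , transport pφ (Image-extend refl im) s

  ∀¹-preserved : {φ : Formula τ Γ (suc m)} → Preserved φ → Preserved (∀¹ φ)
  ∀¹-preserved pφ = preserved λ im s d′ →
    transport pφ (Image-extend (sym (h∘h⁻¹ d′)) im) (s (h⁻¹ d′))

  foPart-preserved : {φ : Formula τ Γ m} → PosFOPart φ → Preserved φ
  foPart-preserved (matrix p) = matrix-preserved p
  foPart-preserved (∃¹ p)     = ∃¹-preserved (foPart-preserved p)
  foPart-preserved (∀¹ p)     = ∀¹-preserved (foPart-preserved p)

  ∃²-preserved : ∀ {a} {φ : Formula τ (a ∷ Γ) m} → Preserved φ → Preserved (∃² a φ)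
  ∃²-preserved pφ = preserved λ im (S , s) →
    S ∘ map h⁻¹ , transport pφ (Image-∷ (cong S ∘ map-h⁻¹∘h) im) s
    where
    map-h⁻¹∘h : ∀ {k} (t : Vec (Dom A) k) → map h⁻¹ (map h t) ≡ t
    map-h⁻¹∘h t = trans (sym (map-∘ h⁻¹ h t)) (trans (map-cong h⁻¹∘h t) (map-id t))

  ∀²-preserved : ∀ {a} {φ : Formula τ (a ∷ Γ) m} → Preserved φ → Preserved (∀² a φ)
  ∀²-preserved pφ = preserved λ im s S′ → transport pφ (Image-∷ (λ t → refl) im) (s (S′ ∘ map h))

  -- An internal conjunction ∃S (φ₁ ∧ φ₂) is not determined by ∃S φ₁ and
  -- ∃S φ₂, so the induction must carry preservation of the body below the
  -- whole second-order prefix.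
  PreservedBody : Formula τ Γ m → Set
  PreservedBody (∃² a φ) = PreservedBody φ
  PreservedBody (∀² a φ) = PreservedBody φ
  PreservedBody φ        = Preserved φ

  body-preserved : (φ : Formula τ Γ m) → PreservedBody φ → Preserved φ
  body-preserved (∃² a φ)    = ∃²-preserved ∘ body-preserved φ
  body-preserved (∀² a φ)    = ∀²-preserved ∘ body-preserved φ
  body-preserved (rel R xs)  = id
  body-preserved (svar v xs) = id
  body-preserved (equ x y)   = id
  body-preserved (neg φ)     = id
  body-preserved (φ ∧ᶠ ψ)    = id
  body-preserved (φ ∨ᶠ ψ)    = id
  body-preserved (∃¹ φ)      = id
  body-preserved (∀¹ φ)      = id

  qf-body : {φ : Formula τ Γ m} → QF φ → Preserved φ → PreservedBody φ
  qf-body (rel R xs)  = id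
  qf-body (svar v xs) = id
  qf-body (equ x y)   = id
  qf-body (neg q)     = id
  qf-body (and q r)   = id
  qf-body (or q r)    = id

  foPart-body : {φ : Formula τ Γ m} → PosFOPart φ → PreservedBody φ
  foPart-body (matrix p@(pos q _ _ _)) = qf-body q (matrix-preserved p)
  foPart-body (∃¹ p)                   = foPart-preserved (∃¹ p)
  foPart-body (∀¹ p)                   = foPart-preserved (∀¹ p)

  normalized-body : {φ : Formula τ Γ m} → PosNormalized φ → PreservedBody φ
  normalized-body (fo p)   = foPart-body p
  normalized-body (∃² a p) = normalized-body p
  normalized-body (∀² a p) = normalized-body p

  join-body : ∀ c (P : SOPrefix) (φ₁ φ₂ : Formula τ (inner Γ P) m) →
    PreservedBody (wrap P φ₁) → PreservedBody (wrap P φ₂) → PreservedBody (wrap P (joinᶠ c φ₁ φ₂))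
  join-body ∧ᶜ [] φ₁ φ₂ b₁ b₂ = ∧-preserved (body-preserved φ₁ b₁) (body-preserved φ₂ b₂)
  join-body ∨ᶜ [] φ₁ φ₂ b₁ b₂ = ∨-preserved (body-preserved φ₁ b₁) (body-preserved φ₂ b₂)
  join-body c ((∃q , a) ∷ P) = join-body c P
  join-body c ((∀q , a) ∷ P) = join-body c P

  positive-body : {Φ : Sentence τ} → PositiveSO Φ → PreservedBody Φ
  positive-body (normalized p)        = normalized-body p
  positive-body (conj P φ₁ φ₂ p₁ p₂) = join-body ∧ᶜ P φ₁ φ₂ (positive-body p₁) (positive-body p₂)
  positive-body (disj P φ₁ φ₂ p₁ p₂) = join-body ∨ᶜ P φ₁ φ₂ (positive-body p₁) (positive-body p₂)

positive⇒preserved : {Φ : Sentence τ} → PositiveSO Φ → PreservedUnderBijHom Φ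
positive⇒preserved {Φ = Φ} positive A B h hom bij =
  transport (body-preserved Φ (positive-body positive)) (image (λ ()) (λ ()))
  where open Preservation {A = A} {B} h hom bij

CNF⁺ : Formula τ Γ m → Set
CNF⁺ φ = ∃ λ χ → φ ≈DM χ × PosCNF χ

∧-≈DM : {φ φ′ ψ ψ′ : Formula τ Γ m} → φ ≈DM φ′ → ψ ≈DM ψ′ → (φ ∧ᶠ ψ) ≈DM (φ′ ∧ᶠ ψ′)
∧-≈DM {φ′ = φ′} {ψ} φ≈φ′ ψ≈ψ′ = gmap (_∧ᶠ ψ) cong-∧ˡ φ≈φ′ ◅◅ gmap (φ′ ∧ᶠ_) cong-∧ʳ ψ≈ψ′

∨-≈DM : {φ φ′ ψ ψ′ : Formula τ Γ m} → φ ≈DM φ′ → ψ ≈DM ψ′ → (φ ∨ᶠ ψ) ≈DM (φ′ ∨ᶠ ψ′)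
∨-≈DM {φ′ = φ′} {ψ} φ≈φ′ ψ≈ψ′ = gmap (_∨ᶠ ψ) cong-∨ˡ φ≈φ′ ◅◅ gmap (φ′ ∨ᶠ_) cong-∨ʳ ψ≈ψ′

clause-∨-cnf : {φ ψ : Formula τ Γ m} → PosClause φ → PosCNF ψ → CNF⁺ (φ ∨ᶠ ψ)
clause-∨-cnf c (clause d) = _ , ε , clause (or c d)
clause-∨-cnf c (and d₁ d₂) =
  let (χ₁ , e₁ , p₁) = clause-∨-cnf c d₁ ; (χ₂ , e₂ , p₂) = clause-∨-cnf c d₂ in
  χ₁ ∧ᶠ χ₂ , fwd dist-∨ˡ ◅ ∧-≈DM e₁ e₂ , and p₁ p₂

∨-cnf : {φ ψ : Formula τ Γ m} → PosCNF φ → PosCNF ψ → CNF⁺ (φ ∨ᶠ ψ)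
∨-cnf (clause c) d = clause-∨-cnf c d
∨-cnf (and c₁ c₂) d =
  let (χ₁ , e₁ , p₁) = ∨-cnf c₁ d ; (χ₂ , e₂ , p₂) = ∨-cnf c₂ d in
  χ₁ ∧ᶠ χ₂ , fwd dist-∨ʳ ◅ ∧-≈DM e₁ e₂ , and p₁ p₂

join-matrix : ∀ c {φ ψ : Formula τ Γ m} → PosMatrix φ → PosMatrix ψ → PosMatrix (joinᶠ c φ ψ)
join-matrix ∧ᶜ (pos qφ φ′ eφ cφ) (pos qψ ψ′ eψ cψ) =
  pos (and qφ qψ) (φ′ ∧ᶠ ψ′) (∧-≈DM eφ eψ) (and cφ cψ)
join-matrix ∨ᶜ (pos qφ φ′ eφ cφ) (pos qψ ψ′ eψ cψ) =
  let (χ , e , p) = ∨-cnf cφ cψ in pos (or qφ qψ) χ (∨-≈DM eφ eψ ◅◅ e) p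

joinᶠ-sat : ∀ c (A : Structure τ) {φ ψ : Formula τ Γ m} {σ ρ} →
  Sat A (joinᶠ c φ ψ) σ ρ ⇔ Join c (Sat A φ σ ρ) (Sat A ψ σ ρ)
joinᶠ-sat ∧ᶜ A = ⇔-id _
joinᶠ-sat ∨ᶜ A = ⇔-id _

PosFO : Signature → List ℕ → ℕ → Set
PosFO τ Γ m = Σ (Formula τ Γ m) PosFOPart

join-matrix-fo : ∀ c {φ ψ : Formula τ Γ m} → PosMatrix φ → PosFOPart ψ → PosFO τ Γ m
join-matrix-fo c {φ} pφ (matrix {φ = ψ} pψ) = joinᶠ c φ ψ , matrix (join-matrix c pφ pψ)
join-matrix-fo c pφ (∃¹ pψ) = mapΣ ∃¹ ∃¹ (join-matrix-fo c (sub-matrix idˢ suc pφ) pψ)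
join-matrix-fo c pφ (∀¹ pψ) = mapΣ ∀¹ ∀¹ (join-matrix-fo c (sub-matrix idˢ suc pφ) pψ)

join-fo : ∀ c {φ ψ : Formula τ Γ m} → PosFOPart φ → PosFOPart ψ → PosFO τ Γ m
join-fo c (matrix pφ) pψ = join-matrix-fo c pφ pψ
join-fo c (∃¹ pφ)     pψ = mapΣ ∃¹ ∃¹ (join-fo c pφ (sub-foPart idˢ suc pψ))
join-fo c (∀¹ pφ)     pψ = mapΣ ∀¹ ∀¹ (join-fo c pφ (sub-foPart idˢ suc pψ))

join-matrix-fo-sat : ∀ c (A : Structure τ) {φ ψ : Formula τ Γ m}
  (pφ : PosMatrix φ) (pψ : PosFOPart ψ) σ ρ →
  Sat A (proj₁ (join-matrix-fo c pφ pψ)) σ ρ ⇔ Join c (Sat A φ σ ρ) (Sat A ψ σ ρ)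
join-matrix-fo-sat c A pφ (matrix pψ) σ ρ = joinᶠ-sat c A
join-matrix-fo-sat c A {φ} pφ (∃¹ pψ) σ ρ =
  Quantify-cong ∃q (λ d → join-matrix-fo-sat c A (sub-matrix idˢ suc pφ) pψ σ (extend d ρ)
                          ⨾ Join-cong c (wkᶠ-sat A φ) (⇔-id _))
  ⨾ prenexʳ ∃q c zero (sat? A φ σ ρ)
join-matrix-fo-sat c A {φ} pφ (∀¹ pψ) σ ρ =
  Quantify-cong ∀q (λ d → join-matrix-fo-sat c A (sub-matrix idˢ suc pφ) pψ σ (extend d ρ)
                          ⨾ Join-cong c (wkᶠ-sat A φ) (⇔-id _))
  ⨾ prenexʳ ∀q c zero (sat? A φ σ ρ)

join-fo-sat : ∀ c (A : Structure τ) {φ ψ : Formula τ Γ m}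
  (pφ : PosFOPart φ) (pψ : PosFOPart ψ) σ ρ →
  Sat A (proj₁ (join-fo c pφ pψ)) σ ρ ⇔ Join c (Sat A φ σ ρ) (Sat A ψ σ ρ)
join-fo-sat c A (matrix pφ) pψ σ ρ = join-matrix-fo-sat c A pφ pψ σ ρ
join-fo-sat c A {ψ = ψ} (∃¹ pφ) pψ σ ρ =
  Quantify-cong ∃q (λ d → join-fo-sat c A pφ (sub-foPart idˢ suc pψ) σ (extend d ρ)
                          ⨾ Join-cong c (⇔-id _) (wkᶠ-sat A ψ))
  ⨾ prenexˡ ∃q c zero (sat? A ψ σ ρ)
join-fo-sat c A {ψ = ψ} (∀¹ pφ) pψ σ ρ =
  Quantify-cong ∀q (λ d → join-fo-sat c A pφ (sub-foPart idˢ suc pψ) σ (extend d ρ)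
                          ⨾ Join-cong c (⇔-id _) (wkᶠ-sat A ψ))
  ⨾ prenexˡ ∀q c zero (sat? A ψ σ ρ)

record PrenexForm (τ : Signature) (Γ : List ℕ) (m : ℕ) : Set where
  constructor prenex
  field
    prefix   : SOPrefix
    {body}   : Formula τ (inner Γ prefix) m
    positive : PosFOPart body
open PrenexForm

⌊_⌋ : PrenexForm τ Γ m → Formula τ Γ m
⌊ N ⌋ = wrap (prefix N) (body N)

wrap-∷-sat : (A : Structure τ) (q : Quant) (a : ℕ) (P : SOPrefix)
  (φ : Formula τ (inner (a ∷ Γ) P) m) → ∀ {σ ρ} →
  Sat A (wrap ((q , a) ∷ P) φ) σ ρ
  ⇔ Quantify q (Relation (Dom A) a) (λ S → Sat A (wrap P φ) (S ∷ σ) ρ)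
wrap-∷-sat A ∃q a P φ = ⇔-id _
wrap-∷-sat A ∀q a P φ = ⇔-id _

wrap-sub-sat : (A : Structure τ) (P : SOPrefix) (f : SOSub Γ Δ n) (g : Fin m → Fin n)
  (φ : Formula τ (inner Γ P) m) {σ′ : SEnv (Dom A) Δ} {ρ′ : Fin n → Dom A} → ∀ {σ ρ} →
  Agrees f σ′ ρ′ σ → (∀ i → ρ′ (g i) ≡ ρ i) →
  Sat A (wrap P (sub (liftᴾ P f) g φ)) σ′ ρ′ ⇔ Sat A (wrap P φ) σ ρ
wrap-sub-sat A P f g φ {σ′} {ρ′} agree reindex =
  ≡⇒⇔ (cong (λ ψ → Sat A ψ σ′ ρ′) (sym (sub-wrap P f g φ))) ⨾ sub-sat A f g (wrap P φ) agree reindex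

quantifyᴾ : Quant → ∀ a → PrenexForm τ (a ∷ Γ) m → PrenexForm τ Γ m
quantifyᴾ q a (prenex P p) = prenex ((q , a) ∷ P) p

quantifyᴾ-sat : (A : Structure τ) (q : Quant) (a : ℕ) (N : PrenexForm τ (a ∷ Γ) m) → ∀ {σ ρ} →
  Sat A ⌊ quantifyᴾ q a N ⌋ σ ρ ⇔ Quantify q (Relation (Dom A) a) (λ S → Sat A ⌊ N ⌋ (S ∷ σ) ρ)
quantifyᴾ-sat A q a (prenex P {φ} p) = wrap-∷-sat A q a P φ

wkᴾ : ∀ {a} → PrenexForm τ Γ m → PrenexForm τ (a ∷ Γ) m
wkᴾ (prenex P p) = prenex P (sub-foPart (liftᴾ P wkˢ) id p)

wkᴾ-sat : (A : Structure τ) (N : PrenexForm τ Γ m) → ∀ {a} {S : Relation (Dom A) a} {σ ρ} →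
  Sat A ⌊ wkᴾ N ⌋ (S ∷ σ) ρ ⇔ Sat A ⌊ N ⌋ σ ρ
wkᴾ-sat A (prenex P {φ} p) = wrap-sub-sat A P wkˢ id φ (agrees λ v t → refl) (λ i → refl)

join-fo-prenex : ∀ c {φ : Formula τ Γ m} → PosFOPart φ → PrenexForm τ Γ m → PrenexForm τ Γ m
join-fo-prenex c pφ (prenex [] pψ) = prenex [] (proj₂ (join-fo c pφ pψ))
join-fo-prenex c pφ (prenex ((q , a) ∷ P) pψ) =
  quantifyᴾ q a (join-fo-prenex c (sub-foPart wkˢ id pφ) (prenex P pψ))

join-prenex : Conn → PrenexForm τ Γ m → PrenexForm τ Γ m → PrenexForm τ Γ m
join-prenex c (prenex [] pφ) N = join-fo-prenex c pφ N
join-prenex c (prenex ((q , a) ∷ P) pφ) N = quantifyᴾ q a (join-prenex c (prenex P pφ) (wkᴾ N))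

join-fo-prenex-sat : ∀ c (A : Structure τ) {φ : Formula τ Γ m}
  (pφ : PosFOPart φ) (N : PrenexForm τ Γ m) σ ρ →
  Sat A ⌊ join-fo-prenex c pφ N ⌋ σ ρ ⇔ Join c (Sat A φ σ ρ) (Sat A ⌊ N ⌋ σ ρ)
join-fo-prenex-sat c A pφ (prenex [] pψ) σ ρ = join-fo-sat c A pφ pψ σ ρ
join-fo-prenex-sat c A {φ} pφ (prenex ((q , a) ∷ P) pψ) σ ρ =
  quantifyᴾ-sat A q a (join-fo-prenex c (sub-foPart wkˢ id pφ) (prenex P pψ))
  ⨾ Quantify-cong q (λ S → join-fo-prenex-sat c A (sub-foPart wkˢ id pφ) (prenex P pψ) (S ∷ σ) ρ
                           ⨾ Join-cong c (wkˢ-sat A φ) (⇔-id _))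
  ⨾ prenexʳ q c (λ _ → false) (sat? A φ σ ρ)
  ⨾ Join-cong c (⇔-id _) (⇔-sym (quantifyᴾ-sat A q a (prenex P pψ)))

join-prenex-sat : ∀ c (A : Structure τ) (N₁ N₂ : PrenexForm τ Γ m) σ ρ →
  Sat A ⌊ join-prenex c N₁ N₂ ⌋ σ ρ ⇔ Join c (Sat A ⌊ N₁ ⌋ σ ρ) (Sat A ⌊ N₂ ⌋ σ ρ)
join-prenex-sat c A (prenex [] pφ) N₂ σ ρ = join-fo-prenex-sat c A pφ N₂ σ ρ
join-prenex-sat c A (prenex ((q , a) ∷ P) pφ) N₂ σ ρ =
  quantifyᴾ-sat A q a (join-prenex c (prenex P pφ) (wkᴾ N₂))
  ⨾ Quantify-cong q (λ S → join-prenex-sat c A (prenex P pφ) (wkᴾ N₂) (S ∷ σ) ρ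
                           ⨾ Join-cong c (⇔-id _) (wkᴾ-sat A N₂))
  ⨾ prenexˡ q c (λ _ → false) (sat? A ⌊ N₂ ⌋ σ ρ)
  ⨾ Join-cong c (⇔-sym (quantifyᴾ-sat A q a (prenex P pφ))) (⇔-id _)

Q¹ : Quant → Formula τ Γ (suc m) → Formula τ Γ m
Q¹ ∃q = ∃¹
Q¹ ∀q = ∀¹

Q¹-sat : (A : Structure τ) (q : Quant) (φ : Formula τ Γ (suc m)) → ∀ {σ ρ} →
  Sat A (Q¹ q φ) σ ρ ⇔ Quantify q (Dom A) (λ d → Sat A φ σ (extend d ρ))
Q¹-sat A ∃q φ = ⇔-id _
Q¹-sat A ∀q φ = ⇔-id _

Q¹-foPart : ∀ q {φ : Formula τ Γ (suc m)} → PosFOPart φ → PosFOPart (Q¹ q φ)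
Q¹-foPart ∃q = ∃¹
Q¹-foPart ∀q = ∀¹

-- The innermost second-order variable S receives the first-order variable 0
-- as a new first argument: S t becomes S′ (x₀ ∷ t).
skolemˢ : ∀ {a} → SOSub (a ∷ Γ) (suc a ∷ Γ) (suc m)
skolemˢ here      = applied (here {a = suc _}) (zero ∷ [])
skolemˢ (there v) = applied {#fixed = 0} (there v) []

quantify¹ : Quant → (P : SOPrefix) {φ : Formula τ (inner Γ P) (suc m)} →
  PosFOPart φ → PrenexForm τ Γ m
quantify¹ q [] p = prenex [] (Q¹-foPart q p)
quantify¹ q ((q′ , a) ∷ P) p =
  quantifyᴾ q′ (suc a) (quantify¹ q P (sub-foPart (liftᴾ P skolemˢ) id p))

quantify¹-sat : (A : Structure τ) (q : Quant) (P : SOPrefix) {φ : Formula τ (inner Γ P) (suc m)}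
  (p : PosFOPart φ) → ∀ σ ρ →
  Sat A ⌊ quantify¹ q P p ⌋ σ ρ ⇔ Quantify q (Dom A) (λ d → Sat A (wrap P φ) σ (extend d ρ))
quantify¹-sat A q [] {φ} p σ ρ = Q¹-sat A q φ
quantify¹-sat A q ((q′ , a) ∷ P) {φ} p σ ρ =
  quantifyᴾ-sat A q′ (suc a) (quantify¹ q P (sub-foPart (liftᴾ P skolemˢ) id p))
  ⨾ Quantify-cong q′ (λ S′ → quantify¹-sat A q P (sub-foPart (liftᴾ P skolemˢ) id p) (S′ ∷ σ) ρ
      ⨾ Quantify-cong q λ d → wrap-sub-sat A P skolemˢ id φ
          (agrees λ { here t → refl ; (there v) t → refl }) (λ i → refl))
  ⨾ Quantify-skolem q′ q (λ d S → Sat A (wrap P φ) (S ∷ σ) (extend d ρ))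
      (sat? A (∃¹ (∀² a (wrap P φ))) σ ρ)
      (λ d → sat? A (∃² a (neg (wrap P φ))) σ (extend d ρ))
      (λ d S → sat? A (wrap P φ) (S ∷ σ) (extend d ρ))
  ⨾ Quantify-cong q (λ d → ⇔-sym (wrap-∷-sat A q′ a P φ))

quantify¹ᴾ : Quant → PrenexForm τ Γ (suc m) → PrenexForm τ Γ m
quantify¹ᴾ q (prenex P p) = quantify¹ q P p

quantify¹ᴾ-sat : (A : Structure τ) (q : Quant) (N : PrenexForm τ Γ (suc m)) → ∀ σ ρ →
  Sat A ⌊ quantify¹ᴾ q N ⌋ σ ρ ⇔ Quantify q (Dom A) (λ d → Sat A ⌊ N ⌋ σ (extend d ρ))
quantify¹ᴾ-sat A q (prenex P p) = quantify¹-sat A q P p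

literalᴾ : {φ : Formula τ Γ m} → PosLiteral φ → PrenexForm τ Γ m
literalᴾ l = prenex [] (matrix (pos (literal-QF l) _ ε (clause (lit l))))
  where
  literal-QF : {φ : Formula τ Γ m} → PosLiteral φ → QF φ
  literal-QF (rel⁺ R xs)  = rel R xs
  literal-QF (svar⁺ v xs) = svar v xs
  literal-QF (svar⁻ v xs) = neg (svar v xs)
  literal-QF (equ⁺ x y)   = equ x y
  literal-QF (equ⁻ x y)   = neg (equ x y)

signed : Bool → Formula τ Γ m → Formula τ Γ m
signed true  φ = φ
signed false φ = neg φ

signed-sat : ∀ b (A : Structure τ) {φ : Formula τ Γ m} {σ ρ} →
  Sat A (signed b φ) σ ρ ⇔ Polarized b (Sat A φ σ ρ)
signed-sat true  A = ⇔-id _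
signed-sat false A = ⇔-id _

signed-svar : ∀ b {a} (v : SVar Γ a) (xs : Vec (Fin m) a) →
  PosLiteral {τ = τ} (signed b (svar v xs))
signed-svar true  = svar⁺
signed-svar false = svar⁻

signed-equ : ∀ b (x y : Fin m) → PosLiteral {τ = τ} {Γ = Γ} (signed b (equ x y))
signed-equ true  = equ⁺
signed-equ false = equ⁻

Renaming : List ℕ → List ℕ → Set
Renaming Γ Δ = ∀ {a} → SVar Γ a → SVar Δ a

liftʳ : ∀ {a} → Renaming Γ Δ → Renaming (a ∷ Γ) (a ∷ Δ)
liftʳ κ here      = here
liftʳ κ (there v) = there (κ v)

SymVars : Signature → List ℕ → Set
SymVars τ Δ = (R : Sym τ) → SVar Δ (arity τ R)

reinterpret : (A : Structure τ) → SEnv (Dom A) Δ → SymVars τ Δ → Structure τ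
reinterpret A σ ι = record { size = size A ; interp = lookupS σ ∘ ι }

-- Each τ-atom R(x̄) becomes the second-order atom ι R (x̄), so every literal
-- produced is positive.
toPrenex : Bool → Renaming Γ Δ → SymVars τ Δ → Formula τ Γ m → PrenexForm τ Δ m
toPrenex b κ ι (rel R xs)  = literalᴾ (signed-svar b (ι R) xs)
toPrenex b κ ι (svar v xs) = literalᴾ (signed-svar b (κ v) xs)
toPrenex b κ ι (equ x y)   = literalᴾ (signed-equ b x y)
toPrenex b κ ι (neg φ)     = toPrenex (not b) κ ι φ
toPrenex b κ ι (φ ∧ᶠ ψ)    = join-prenex (polarᶜ b ∧ᶜ) (toPrenex b κ ι φ) (toPrenex b κ ι ψ)
toPrenex b κ ι (φ ∨ᶠ ψ)    = join-prenex (polarᶜ b ∨ᶜ) (toPrenex b κ ι φ) (toPrenex b κ ι ψ)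
toPrenex b κ ι (∃¹ φ)      = quantify¹ᴾ (polarᵠ b ∃q) (toPrenex b κ ι φ)
toPrenex b κ ι (∀¹ φ)      = quantify¹ᴾ (polarᵠ b ∀q) (toPrenex b κ ι φ)
toPrenex b κ ι (∃² a φ)    = quantifyᴾ (polarᵠ b ∃q) a (toPrenex b (liftʳ κ) (there ∘ ι) φ)
toPrenex b κ ι (∀² a φ)    = quantifyᴾ (polarᵠ b ∀q) a (toPrenex b (liftʳ κ) (there ∘ ι) φ)

toPrenex-sat : ∀ b (κ : Renaming Γ Δ) (ι : SymVars τ Δ) (φ : Formula τ Γ m)
  (A : Structure τ) σ′ σ ρ →
  (∀ {a} (v : SVar Γ a) → lookupS σ′ (κ v) ≗ lookupS σ v) →
  Sat A ⌊ toPrenex b κ ι φ ⌋ σ′ ρ ⇔ Polarized b (Sat (reinterpret A σ′ ι) φ σ ρ)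
toPrenex-sat b κ ι (rel R xs) A σ′ σ ρ κσ′≗σ = signed-sat b A
toPrenex-sat b κ ι (svar v xs) A σ′ σ ρ κσ′≗σ =
  signed-sat b A ⨾ Polarized-cong b (≡⇒⇔ (cong T (κσ′≗σ v (map ρ xs))))
toPrenex-sat b κ ι (equ x y) A σ′ σ ρ κσ′≗σ = signed-sat b A
toPrenex-sat b κ ι (neg φ) A σ′ σ ρ κσ′≗σ =
  toPrenex-sat (not b) κ ι φ A σ′ σ ρ κσ′≗σ
  ⨾ Polarized-not b (sat? _ φ σ ρ)
toPrenex-sat b κ ι (φ ∧ᶠ ψ) A σ′ σ ρ κσ′≗σ =
  join-prenex-sat (polarᶜ b ∧ᶜ) A (toPrenex b κ ι φ) (toPrenex b κ ι ψ) σ′ ρ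
  ⨾ Join-cong (polarᶜ b ∧ᶜ) (toPrenex-sat b κ ι φ A σ′ σ ρ κσ′≗σ)
                            (toPrenex-sat b κ ι ψ A σ′ σ ρ κσ′≗σ)
  ⨾ Join-polarized b ∧ᶜ (sat? _ φ σ ρ)
toPrenex-sat b κ ι (φ ∨ᶠ ψ) A σ′ σ ρ κσ′≗σ =
  join-prenex-sat (polarᶜ b ∨ᶜ) A (toPrenex b κ ι φ) (toPrenex b κ ι ψ) σ′ ρ
  ⨾ Join-cong (polarᶜ b ∨ᶜ) (toPrenex-sat b κ ι φ A σ′ σ ρ κσ′≗σ)
                            (toPrenex-sat b κ ι ψ A σ′ σ ρ κσ′≗σ)
  ⨾ Join-polarized b ∨ᶜ (sat? _ φ σ ρ)
toPrenex-sat b κ ι (∃¹ φ) A σ′ σ ρ κσ′≗σ =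
  quantify¹ᴾ-sat A (polarᵠ b ∃q) (toPrenex b κ ι φ) σ′ ρ
  ⨾ Quantify-cong (polarᵠ b ∃q) (λ d → toPrenex-sat b κ ι φ A σ′ σ (extend d ρ) κσ′≗σ)
  ⨾ Quantify-polarized b ∃q (sat? _ (∃¹ (neg φ)) σ ρ) (λ d → sat? _ φ σ (extend d ρ))
toPrenex-sat b κ ι (∀¹ φ) A σ′ σ ρ κσ′≗σ =
  quantify¹ᴾ-sat A (polarᵠ b ∀q) (toPrenex b κ ι φ) σ′ ρ
  ⨾ Quantify-cong (polarᵠ b ∀q) (λ d → toPrenex-sat b κ ι φ A σ′ σ (extend d ρ) κσ′≗σ)
  ⨾ Quantify-polarized b ∀q (sat? _ (∃¹ (neg φ)) σ ρ) (λ d → sat? _ φ σ (extend d ρ))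
toPrenex-sat b κ ι (∃² a φ) A σ′ σ ρ κσ′≗σ =
  quantifyᴾ-sat A (polarᵠ b ∃q) a (toPrenex b (liftʳ κ) (there ∘ ι) φ)
  ⨾ Quantify-cong (polarᵠ b ∃q) (λ S → toPrenex-sat b (liftʳ κ) (there ∘ ι) φ A (S ∷ σ′) (S ∷ σ) ρ
      λ { here t → refl ; (there v) → κσ′≗σ v })
  ⨾ Quantify-polarized b ∃q (sat? _ (∃² a (neg φ)) σ ρ) (λ S → sat? _ φ (S ∷ σ) ρ)
toPrenex-sat b κ ι (∀² a φ) A σ′ σ ρ κσ′≗σ =
  quantifyᴾ-sat A (polarᵠ b ∀q) a (toPrenex b (liftʳ κ) (there ∘ ι) φ)
  ⨾ Quantify-cong (polarᵠ b ∀q) (λ S → toPrenex-sat b (liftʳ κ) (there ∘ ι) φ A (S ∷ σ′) (S ∷ σ) ρ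
      λ { here t → refl ; (there v) → κσ′≗σ v })
  ⨾ Quantify-polarized b ∀q (sat? _ (∃² a (neg φ)) σ ρ) (λ S → sat? _ φ (S ∷ σ) ρ)

∀ⁿ : (k : ℕ) → Formula τ Γ k → Formula τ Γ 0
∀ⁿ zero    φ = φ
∀ⁿ (suc k) φ = ∀ⁿ k (∀¹ φ)

∀ⁿ-foPart : (k : ℕ) {φ : Formula τ Γ k} → PosFOPart φ → PosFOPart (∀ⁿ k φ)
∀ⁿ-foPart zero    p = p
∀ⁿ-foPart (suc k) p = ∀ⁿ-foPart k (∀¹ p)

envOf : ∀ {D : Set} {k} → Vec D k → Fin k → D
envOf []      = noVars
envOf (d ∷ t) = extend d (envOf t)

map-envOf-allFin : ∀ {D : Set} {k} (t : Vec D k) → map (envOf t) (allFin k) ≡ t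
map-envOf-allFin t =
  trans (sym (tabulate-allFin (envOf t)))
        (trans (tabulate-cong (envOf≗lookup t)) (tabulate∘lookup t))
  where
  envOf≗lookup : ∀ {D : Set} {k} (t : Vec D k) → envOf t ≗ lookup t
  envOf≗lookup (d ∷ t) zero    = refl
  envOf≗lookup (d ∷ t) (suc i) = envOf≗lookup t i

∀ⁿ-sat : (A : Structure τ) (k : ℕ) (φ : Formula τ Γ k) {σ : SEnv (Dom A) Γ} →
  Sat A (∀ⁿ k φ) σ noVars ⇔ (∀ t → Sat A φ σ (envOf t))
∀ⁿ-sat A zero    φ = mk⇔ (λ { s [] → s }) (λ s → s [])
∀ⁿ-sat A (suc k) φ = ∀ⁿ-sat A k (∀¹ φ) ⨾ mk⇔ (λ { s (d ∷ t) → s t d }) (λ s t d → s (d ∷ t))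

∃* : ∀ Γ → Formula τ Γ m → Formula τ [] m
∃* []      φ = φ
∃* (a ∷ Γ) φ = ∃* Γ (∃² a φ)

∃*-sat : (A : Structure τ) (Γ : List ℕ) (φ : Formula τ Γ m) {ρ : Fin m → Dom A} →
  Sat A (∃* Γ φ) [] ρ ⇔ ∃ λ σ → Sat A φ σ ρ
∃*-sat A []      φ = mk⇔ ([] ,_) (λ { ([] , s) → s })
∃*-sat A (a ∷ Γ) φ =
  ∃*-sat A Γ (∃² a φ) ⨾ mk⇔ (λ (σ , S , s) → S ∷ σ , s) (λ { (S ∷ σ , s) → σ , S , s })

∃*-normalized : ∀ Γ {φ : Formula τ Γ m} → PosNormalized φ → PosNormalized (∃* Γ φ)
∃*-normalized []      p = p
∃*-normalized (a ∷ Γ) p = ∃*-normalized Γ (∃² a p)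

wrap-normalized : (P : SOPrefix) {φ : Formula τ (inner Γ P) m} →
  PosFOPart φ → PosNormalized (wrap P φ)
wrap-normalized []             p = fo p
wrap-normalized ((∃q , a) ∷ P) p = ∃² a (wrap-normalized P p)
wrap-normalized ((∀q , a) ∷ P) p = ∀² a (wrap-normalized P p)

tabulate-var : ∀ {n} (ar : Fin n → ℕ) (i : Fin n) → SVar (tabulate ar) (ar i)
tabulate-var ar zero    = here
tabulate-var ar (suc i) = there (tabulate-var (ar ∘ suc) i)

tabulate-env : ∀ {D : Set} {n} {ar : Fin n → ℕ} →
  ((i : Fin n) → Relation D (ar i)) → SEnv D (tabulate ar)
tabulate-env {n = zero}  F = []
tabulate-env {n = suc n} F = F zero ∷ tabulate-env (F ∘ suc)

lookup-tabulate-env : ∀ {D : Set} {n} {ar : Fin n → ℕ} (F : (i : Fin n) → Relation D (ar i)) i →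
  lookupS (tabulate-env F) (tabulate-var ar i) ≡ F i
lookup-tabulate-env F zero    = refl
lookup-tabulate-env F (suc i) = lookup-tabulate-env (F ∘ suc) i

module PositiveForm (τ : Signature) where

  Γτ : List ℕ
  Γτ = tabulate (arity τ)

  symVar : (R : Sym τ) → SVar Γτ (arity τ R)
  symVar = tabulate-var (arity τ)

  inclusion : (R : Sym τ) → Formula τ Γτ 0
  inclusion R = ∀ⁿ (arity τ R) (neg (svar (symVar R) (allFin _)) ∨ᶠ rel R (allFin _))

  inclusion-foPart : (R : Sym τ) → PosFOPart (inclusion R)
  inclusion-foPart R = ∀ⁿ-foPart (arity τ R)
    (matrix (pos (or (neg (svar _ _)) (rel _ _)) _ ε
                 (clause (or (lit (svar⁻ _ _)) (lit (rel⁺ _ _))))))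

  Included : (A : Structure τ) → SEnv (Dom A) Γτ → Sym τ → Set
  Included A σ R = ∀ t → T (lookupS σ (symVar R) t) → T (interp A R t)

  inclusion-sat : (A : Structure τ) (σ : SEnv (Dom A) Γτ) (R : Sym τ) →
    Sat A (inclusion R) σ noVars ⇔ Included A σ R
  inclusion-sat A σ R = ∀ⁿ-sat A (arity τ R) _ ⨾ mk⇔ sound complete
    where
    S : Relation (Dom A) (arity τ R)
    S = lookupS σ (symVar R)

    Clause : Vec (Dom A) (arity τ R) → Set
    Clause t = ¬ T (S (map (envOf t) (allFin _))) ⊎ T (interp A R (map (envOf t) (allFin _)))

    sound : (∀ t → Clause t) → Included A σ R
    sound clauses t St with clauses t
    ... | inj₁ ¬St = ⊥-elim (¬St (subst (T ∘ S) (sym (map-envOf-allFin t)) St))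
    ... | inj₂ Rt  = subst (T ∘ interp A R) (map-envOf-allFin t) Rt

    complete : Included A σ R → ∀ t → Clause t
    complete incl t with T? (S (map (envOf t) (allFin _)))
    ... | yes St = inj₂ (incl _ St)
    ... | no ¬St = inj₁ ¬St

  withInclusions : ∀ n → (Fin n → Sym τ) → PrenexForm τ Γτ 0 → PrenexForm τ Γτ 0
  withInclusions zero    Rs N = N
  withInclusions (suc n) Rs N =
    join-fo-prenex ∧ᶜ (inclusion-foPart (Rs zero)) (withInclusions n (Rs ∘ suc) N)

  withInclusions-sat : (A : Structure τ) (n : ℕ) (Rs : Fin n → Sym τ) (N : PrenexForm τ Γτ 0) →
    ∀ σ →
    Sat A ⌊ withInclusions n Rs N ⌋ σ noVars ⇔ ((∀ i → Included A σ (Rs i)) × Sat A ⌊ N ⌋ σ noVars)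
  withInclusions-sat A zero    Rs N σ = mk⇔ ((λ ()) ,_) proj₂
  withInclusions-sat A (suc n) Rs N σ =
    join-fo-prenex-sat ∧ᶜ A (inclusion-foPart (Rs zero)) (withInclusions n (Rs ∘ suc) N) σ noVars
    ⨾ (inclusion-sat A σ (Rs zero) ×-⇔ withInclusions-sat A n (Rs ∘ suc) N σ)
    ⨾ mk⇔ (λ (incl₀ , incls , s) → (λ { zero → incl₀ ; (suc i) → incls i }) , s)
          (λ (incls , s) → incls zero , incls ∘ suc , s)

  Ψ : Sentence τ → Sentence τ
  Ψ Φ = ∃* Γτ ⌊ withInclusions (nsym τ) id (toPrenex true (λ ()) symVar Φ) ⌋

  Ψ-positive : (Φ : Sentence τ) → PositiveSO (Ψ Φ)
  Ψ-positive Φ = normalized (∃*-normalized Γτ (wrap-normalized _ (positive N)))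
    where N = withInclusions (nsym τ) id (toPrenex true (λ ()) symVar Φ)

  Ψ-sat : (Φ : Sentence τ) (A : Structure τ) →
    A ⊨ Ψ Φ ⇔ ∃ λ σ → (∀ R → Included A σ R) × reinterpret A σ symVar ⊨ Φ
  Ψ-sat Φ A = ∃*-sat A Γτ _ ⨾ Quantify-cong ∃q λ σ →
    withInclusions-sat A (nsym τ) id (toPrenex true (λ ()) symVar Φ) σ
    ⨾ (⇔-id _ ×-⇔ toPrenex-sat true (λ ()) symVar Φ A σ [] noVars (λ ()))

  ownEnv : (A : Structure τ) → SEnv (Dom A) Γτ
  ownEnv A = tabulate-env (interp A)

  ownEnv-symVar : (A : Structure τ) (R : Sym τ) → lookupS (ownEnv A) (symVar R) ≡ interp A R
  ownEnv-symVar A = lookup-tabulate-env (interp A)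

  ownEnv-included : (A : Structure τ) (R : Sym τ) → Included A (ownEnv A) R
  ownEnv-included A R t = subst T (cong (λ S → S t) (ownEnv-symVar A R))

  ownEnv-id-hom : (A : Structure τ) → IsHom A (reinterpret A (ownEnv A) symVar) id
  ownEnv-id-hom A R t =
    subst (λ S → T (S (map id t))) (sym (ownEnv-symVar A R)) ∘ subst (T ∘ interp A R) (sym (map-id t))

  included-id-hom : (A : Structure τ) (σ : SEnv (Dom A) Γτ) → (∀ R → Included A σ R) →
    IsHom (reinterpret A σ symVar) A id
  included-id-hom A σ included R t = subst (T ∘ interp A R) (sym (map-id t)) ∘ included R t

  preserved⇒Ψ-equivalent : (Φ : Sentence τ) → PreservedUnderBijHom Φ → Equivalent Φ (Ψ Φ)
  preserved⇒Ψ-equivalent Φ preserved A = mk⇔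
    (λ s → from (Ψ-sat Φ A)
      (ownEnv A , ownEnv-included A , preserved A _ id (ownEnv-id-hom A) (bijective _≡_) s))
    (λ s → let (σ , included , s′) = to (Ψ-sat Φ A) s in
      preserved _ A id (included-id-hom A σ included) (bijective _≡_) s′)

Equivalent-preserved : (Φ Ψ : Sentence τ) → Equivalent Φ Ψ →
  PreservedUnderBijHom Ψ → PreservedUnderBijHom Φ
Equivalent-preserved Φ Ψ Φ⇔Ψ preserved A B h hom bij =
  from (Φ⇔Ψ B) ∘ preserved A B h hom bij ∘ to (Φ⇔Ψ A)

lemma3p3 : (τ : Signature) (Φ : Sentence τ) →
    PreservedUnderBijHom Φ ⇔ (Σ (Sentence τ) λ Ψ → PositiveSO Ψ × Equivalent Φ Ψ)
lemma3p3 τ Φ = mk⇔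
  (λ preserved → Ψ Φ , Ψ-positive Φ , preserved⇒Ψ-equivalent Φ preserved)
  (λ (Ψ′ , positive , Φ⇔Ψ′) → Equivalent-preserved Φ Ψ′ Φ⇔Ψ′ (positive⇒preserved positive))
  where open PositiveForm τ
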